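{- Let $L[1,t]$ be an array of integers in $[1,D]$ and let $E[1,t]$ be defined by $E[k]=\max\{l<k: L[l]=L[k]\}$, or $E[k]=0$ if no such $l$ exists. Given $1\le sp\le ep\le t$, consider the following ``leftist'' algorithm, which maintains a global set of already reported values (initially empty) and calls $\mathrm{Process}(sp,ep)$, where $\mathrm{Process}(i,j)$ does: if $i>j$, return; set $d\leftarrow i$; while $d\le j$ and $L[d]$ has not been reported, report $L[d]$ and set $d\leftarrow d+1$; if $d>j$, return; let $k\in[d,j]$ be a position where $E[k]$ is minimum in $E[d,j]$; if $L[k]$ has already been reported, return; otherwise report $L[k]$ and call $\mathrm{Process}(d,k-1)$ and then $\mathrm{Process}(k+1,j)$. Then this algorithm reports exactly the $\mathit{ndoc}$ distinct values occurring in $L[sp,ep]$, each exactly once, in $O(\mathit{ndoc})$ steps (where a step is a constant number of elementary operations, accesses to $L$, membership tests/insertions in the set of reported values, and range-minimum computations on $E$). -}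

module Defs where

open import Data.Nat using (ℕ; zero; suc; _+_; _∸_; _≤_; _<_; _≡ᵇ_)
open import Data.Nat.Properties using (_≟_)
open import Data.Bool using (if_then_else_)
open import Data.List using (List; []; _∷_; map; upTo; length; deduplicate)
open import Data.List.Membership.Propositional using (_∈_; _∉_)
open import Data.Product using (_×_)

-- Arrays L[1,t] are modelled as functions ℕ → ℕ (only positions 1..t matter).

lastOcc : (ℕ → ℕ) → ℕ → ℕ → ℕ
lastOcc L v zero    = 0
lastOcc L v (suc m) = if L (suc m) ≡ᵇ v then suc m else lastOcc L v m

E : (ℕ → ℕ) → ℕ → ℕ
E L k = lastOcc L (L k) (k ∸ 1)

IsMinPos : (ℕ → ℕ) → ℕ → ℕ → ℕ → Set
IsMinPos L d j k = d ≤ k × k ≤ j × (∀ m → d ≤ m → m ≤ j → E L k ≤ E L m)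

range : ℕ → ℕ → List ℕ
range sp ep = map (sp +_) (upTo (suc ep ∸ sp))

ndoc : (ℕ → ℕ) → ℕ → ℕ → ℕ
ndoc L sp ep = length (deduplicate _≟_ (map L (range sp ep)))

-- The set of reported values is a list R,
-- "report v" conses v onto R (so R lists reported values, most recent first).
-- The last index counts steps: one step per call to Process (covering the
-- i>j test, the final failing loop test, the range-minimum query, the membership
-- test and report of L[k]) plus one step per iteration of the while loop.

data Loop (L : ℕ → ℕ) : ℕ → ℕ → List ℕ → ℕ → List ℕ → ℕ → Set where
  loop-end  : ∀ {d j R} → j < d → Loop L d j R d R 0
  loop-seen : ∀ {d j R} → d ≤ j → L d ∈ R → Loop L d j R d R 0
  loop-step : ∀ {d j R d' R' s} → d ≤ j → L d ∉ R →
              Loop L (suc d) j (L d ∷ R) d' R' s → Loop L d j R d' R' (suc s)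

-- Proc L i j R R' s : Process(i,j) started with reported set R ends with R' in s steps.
-- The choice of k is nondeterministic: any position of minimum E in [d,j].
data Proc (L : ℕ → ℕ) : ℕ → ℕ → List ℕ → List ℕ → ℕ → Set where
  proc-empty : ∀ {i j R} → j < i → Proc L i j R R 1
  proc-done  : ∀ {i j R d R₁ s} → i ≤ j → Loop L i j R d R₁ s → j < d →
               Proc L i j R R₁ (suc s)
  proc-stop  : ∀ {i j R d R₁ s k} → i ≤ j → Loop L i j R d R₁ s → d ≤ j →
               IsMinPos L d j k → L k ∈ R₁ → Proc L i j R R₁ (suc s)
  proc-rec   : ∀ {i j R d R₁ s k R₂ s₁ R₃ s₂} → i ≤ j → Loop L i j R d R₁ s → d ≤ j →
               IsMinPos L d j k → L k ∉ R₁ →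
               Proc L d (k ∸ 1) (L k ∷ R₁) R₂ s₁ →
               Proc L (suc k) j R₂ R₃ s₂ →
               Proc L i j R R₃ (suc (s + s₁ + s₂))

-- Process(i,j) is entered with every value of L[sp,i) already reported and
-- with every reported value that occurs in L[i,j] already occurring in L[sp,i).
-- Let the loop stop at d and let k minimise E on [d,j].  If L[k] is reported,
-- it occurs in [sp,d), so sp ≤ E[k] ≤ E[m] for every m in [d,j]; following E
-- backwards from m then stays in [sp,j] until it reaches the reported prefix,
-- so all of L[d,j] is reported and returning is correct.  Otherwise
-- E[k] ≤ E[d] < d, so L[k] does not occur in [d,k) and the invariant holds for
-- both recursive calls.  Every report follows a failed membership test, so no
-- value is reported twice, and each report pays for at most three steps.

module Submission where

open import Defs
open import Data.Nat using (ℕ; zero; suc; _*_; _≤_; _<_; _+_; _∸_; z≤n; z<s; s≤s; s≤s⁻¹; _≡ᵇ_; _≤?_; _<?_)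
open import Data.Nat.Properties
open import Data.Nat.Induction using (<-rec)
open import Data.Nat.Tactic.RingSolver using (solve-∀)
open import Data.Bool using (true; false; T)
open import Data.Empty using (⊥-elim)
open import Data.Sum using (_⊎_; inj₁; inj₂)
open import Data.List using (List; []; _∷_; length; map; deduplicate)
open import Data.List.Extrema.Nat using (argmin; argmin-all; f[argmin]≤f[xs])
open import Data.List.Membership.Propositional using (_∈_; _∉_)
open import Data.List.Membership.Propositional.Properties using (∈-map⁺; ∈-map⁻; ∈-upTo⁺; ∈-upTo⁻; ∈-length; deduplicate-∈⇔)
open import Data.List.Membership.DecPropositional _≟_ using (_∈?_)
open import Data.List.Relation.Binary.Subset.Propositional using (_⊆_)
open import Data.List.Relation.Unary.Any using (here; there)
import Data.List.Relation.Unary.All as All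
open import Data.List.Relation.Unary.All.Properties using (¬Any⇒All¬)
open import Data.List.Relation.Unary.Unique.Propositional using (Unique)
open import Data.List.Relation.Unary.AllPairs using (_∷_; [])
open import Data.List.Relation.Unary.Unique.DecPropositional.Properties _≟_ using (deduplicate-!)
open import Data.List.Membership.Propositional.Properties.WithK using (unique∧set⇒bag)
open import Data.List.Relation.Binary.BagAndSetEquality using (∼bag⇒↭)
open import Data.List.Relation.Binary.Permutation.Propositional.Properties using (↭-length)
open import Data.Product using (_×_; _,_; ∃-syntax; ∃₂; proj₁; proj₂)
open import Relation.Binary.PropositionalEquality using (_≡_; refl; sym; trans; cong; subst; module ≡-Reasoning)
open import Relation.Nullary using (yes; no)
open import Function.Bundles using (_⇔_; mk⇔; Equivalence)

private
  variable
    a b i j d k p q s s₁ s₂ sp v : ℕ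
    R R₁ R₂ R₃ : List ℕ

<⇒≤∸1 : p < k → p ≤ k ∸ 1
<⇒≤∸1 {k = suc _} = s≤s⁻¹

≤∸1⇒< : 1 ≤ k → p ≤ k ∸ 1 → p < k
≤∸1⇒< {k = suc _} _ = s≤s

∈-range⁻ : a ≤ b → p ∈ range a b → a ≤ p × p ≤ b
∈-range⁻ {a} a≤b p∈ with ∈-map⁻ (a +_) p∈
... | x , x∈ , refl =
  m≤m+n a x , s≤s⁻¹ (subst (a + x <_) (m+[n∸m]≡n (m≤n⇒m≤1+n a≤b)) (+-monoʳ-< a (∈-upTo⁻ x∈)))

∈-range⁺ : a ≤ p → p ≤ b → p ∈ range a b
∈-range⁺ {a} {p} {b} a≤p p≤b =
  subst (_∈ range a b) (m+[n∸m]≡n a≤p) (∈-map⁺ (a +_) (∈-upTo⁺ (∸-monoˡ-< (s≤s p≤b) a≤p)))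

length-identity : ∀ s a b n → b + (a + suc (s + n)) ≡ (s + suc a + b) + n
length-identity = solve-∀

cost-identity : ∀ s a b → s + suc (3 * a) + suc (3 * b) + (2 * s + 1) ≡ 3 * (s + suc a + b)
cost-identity = solve-∀

recursive-calls-shrink : ∀ {n} → 1 ≤ i → i ≤ d → d ≤ k → k ≤ j → j < i + suc n →
                         k ∸ 1 < d + n × j < suc k + n
recursive-calls-shrink {i = i} {j = j} {n = n} 1≤i i≤d d≤k k≤j j<i+1+n =
  <-≤-trans (≤∸1⇒< (≤-trans 1≤i (≤-trans i≤d d≤k)) ≤-refl)
            (≤-trans k≤j (≤-trans j≤i+n (+-monoˡ-≤ n i≤d))) ,
  s≤s (≤-trans j≤i+n (+-monoˡ-≤ n (≤-trans i≤d d≤k)))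
  where
  j≤i+n : j ≤ i + n
  j≤i+n = s≤s⁻¹ (subst (j <_) (+-suc i n) j<i+1+n)

unique-∷ : v ∉ R → Unique R → Unique (v ∷ R)
unique-∷ {R = R} v∉R u = ¬Any⇒All¬ R v∉R ∷ u

module _ (L : ℕ → ℕ) where

  Occurs : ℕ → ℕ → ℕ → Set
  Occurs a b v = ∃[ p ] (a ≤ p × p ≤ b × L p ≡ v)

  lastOcc-≤ : ∀ v m → lastOcc L v m ≤ m
  lastOcc-≤ v zero = z≤n
  lastOcc-≤ v (suc m) with L (suc m) ≡ᵇ v
  ... | true  = ≤-refl
  ... | false = m≤n⇒m≤1+n (lastOcc-≤ v m)

  lastOcc-value : ∀ v m → 1 ≤ lastOcc L v m → L (lastOcc L v m) ≡ v
  lastOcc-value v (suc m) h with L (suc m) ≡ᵇ v in eq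
  ... | true  = ≡ᵇ⇒≡ (L (suc m)) v (subst T (sym eq) _)
  ... | false = lastOcc-value v m h

  lastOcc-maximal : ∀ v m → 1 ≤ p → p ≤ m → L p ≡ v → p ≤ lastOcc L v m
  lastOcc-maximal v zero    (s≤s _) ()
  lastOcc-maximal {p} v (suc m) 1≤p p≤1+m Lp≡v with L (suc m) ≡ᵇ v in eq
  ... | true = p≤1+m
  ... | false with m≤n⇒m<n∨m≡n p≤1+m
  ...   | inj₁ p≤m = lastOcc-maximal v m 1≤p (s≤s⁻¹ p≤m) Lp≡v
  ...   | inj₂ refl = ⊥-elim (subst T eq (≡⇒≡ᵇ (L p) v Lp≡v))

  E-< : 1 ≤ k → E L k < k
  E-< {suc k} _ = s≤s (lastOcc-≤ (L (suc k)) k)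

  E-value : 1 ≤ E L k → L (E L k) ≡ L k
  E-value {k} = lastOcc-value (L k) (k ∸ 1)

  E-maximal : 1 ≤ q → q < k → L q ≡ L k → q ≤ E L k
  E-maximal {k = suc k} 1≤q q<k = lastOcc-maximal (L (suc k)) k 1≤q (s≤s⁻¹ q<k)

  loop-≤ : Loop L i j R d R₁ s → i ≤ d
  loop-≤ (loop-end _)        = ≤-refl
  loop-≤ (loop-seen _ _)     = ≤-refl
  loop-≤ (loop-step _ _ run) = <⇒≤ (loop-≤ run)

  loop-⊆ : Loop L i j R d R₁ s → R ⊆ R₁
  loop-⊆ (loop-end _)        = λ v∈ → v∈
  loop-⊆ (loop-seen _ _)     = λ v∈ → v∈
  loop-⊆ (loop-step _ _ run) = λ v∈ → loop-⊆ run (there v∈)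

  loop-sound : Loop L i j R d R₁ s → v ∈ R₁ → v ∈ R ⊎ Occurs i j v
  loop-sound (loop-end _)    v∈ = inj₁ v∈
  loop-sound (loop-seen _ _) v∈ = inj₁ v∈
  loop-sound {i} (loop-step i≤j _ run) v∈ with loop-sound run v∈
  ... | inj₁ (here refl)         = inj₂ (i , ≤-refl , i≤j , refl)
  ... | inj₁ (there v∈R)         = inj₁ v∈R
  ... | inj₂ (p , i<p , p≤j , e) = inj₂ (p , <⇒≤ i<p , p≤j , e)

  loop-unique : Loop L i j R d R₁ s → Unique R → Unique R₁
  loop-unique (loop-end _)         u = u
  loop-unique (loop-seen _ _)      u = u
  loop-unique (loop-step _ v∉ run) u = loop-unique run (unique-∷ v∉ u)

  loop-length : Loop L i j R d R₁ s → length R₁ ≡ s + length R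
  loop-length (loop-end _)    = refl
  loop-length (loop-seen _ _) = refl
  loop-length {R = R} (loop-step {s = s} _ _ run) =
    trans (loop-length run) (+-suc s (length R))

  proc-⊆ : Proc L i j R R₁ s → R ⊆ R₁
  proc-⊆ (proc-empty _)                    = λ v∈ → v∈
  proc-⊆ (proc-done _ run _)               = loop-⊆ run
  proc-⊆ (proc-stop _ run _ _ _)           = loop-⊆ run
  proc-⊆ (proc-rec _ run _ _ _ left right) = λ v∈ → proc-⊆ right (proc-⊆ left (there (loop-⊆ run v∈)))

  proc-sound : Proc L i j R R₁ s → v ∈ R₁ → v ∈ R ⊎ Occurs i j v
  proc-sound (proc-empty _)          v∈ = inj₁ v∈
  proc-sound (proc-done _ run _)     v∈ = loop-sound run v∈
  proc-sound (proc-stop _ run _ _ _) v∈ = loop-sound run v∈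
  proc-sound (proc-rec {k = k} _ run _ (d≤k , k≤j , _) _ left right) v∈
    with proc-sound right v∈
  ... | inj₂ (p , k<p , p≤j , e) = inj₂ (p , ≤-trans (loop-≤ run) (≤-trans d≤k (<⇒≤ k<p)) , p≤j , e)
  ... | inj₁ v∈R₂ with proc-sound left v∈R₂
  ...   | inj₁ (here refl) = inj₂ (k , ≤-trans (loop-≤ run) d≤k , k≤j , refl)
  ...   | inj₁ (there v∈R₁) = loop-sound run v∈R₁
  ...   | inj₂ (p , d≤p , p≤k∸1 , e) =
    inj₂ (p , ≤-trans (loop-≤ run) d≤p , ≤-trans (≤-trans p≤k∸1 (m∸n≤m k 1)) k≤j , e)

  proc-unique : Proc L i j R R₁ s → Unique R → Unique R₁
  proc-unique (proc-empty _)                        u = u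
  proc-unique (proc-done _ run _)                   u = loop-unique run u
  proc-unique (proc-stop _ run _ _ _)               u = loop-unique run u
  proc-unique (proc-rec _ run _ _ Lk∉ left right) u =
    proc-unique right (proc-unique left (unique-∷ Lk∉ (loop-unique run u)))

  -- Each call to Process is charged one step and each report three: one for the
  -- loop iteration or call that made it and one for each of the (at most two)
  -- calls it spawns.
  proc-cost : Proc L i j R R₁ s → ∃[ r ] (length R₁ ≡ r + length R × s ≤ suc (3 * r))
  proc-cost (proc-empty _)                  = 0 , refl , ≤-refl
  proc-cost (proc-done {s = s} _ run _)     = s , loop-length run , s≤s (m≤m+n s (2 * s))
  proc-cost (proc-stop {s = s} _ run _ _ _) = s , loop-length run , s≤s (m≤m+n s (2 * s))
  proc-cost {R = R} (proc-rec {R₁ = R₁} {s = s} {R₂ = R₂} {s₁ = s₁} {R₃ = R₃} {s₂ = s₂} _ run _ _ _ left right)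
    with proc-cost left | proc-cost right
  ... | r₁ , len₁ , s₁≤ | r₂ , len₂ , s₂≤ = s + suc r₁ + r₂ , length≡ , s≤
    where
    length≡ : length R₃ ≡ (s + suc r₁ + r₂) + length R
    length≡ = begin
      length R₃                             ≡⟨ len₂ ⟩
      r₂ + length R₂                        ≡⟨ cong (r₂ +_) len₁ ⟩
      r₂ + (r₁ + suc (length R₁))           ≡⟨ cong (λ n → r₂ + (r₁ + suc n)) (loop-length run) ⟩
      r₂ + (r₁ + suc (s + length R))        ≡⟨ length-identity s r₁ r₂ (length R) ⟩
      (s + suc r₁ + r₂) + length R          ∎
      where open ≡-Reasoning
    s≤ : suc (s + s₁ + s₂) ≤ suc (3 * (s + suc r₁ + r₂))
    s≤ = s≤s (begin
      s + s₁ + s₂                                        ≤⟨ +-mono-≤ (+-monoʳ-≤ s s₁≤) s₂≤ ⟩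
      s + suc (3 * r₁) + suc (3 * r₂)                    ≤⟨ m≤m+n _ (2 * s + 1) ⟩
      s + suc (3 * r₁) + suc (3 * r₂) + (2 * s + 1)      ≡⟨ cost-identity s r₁ r₂ ⟩
      3 * (s + suc r₁ + r₂)                              ∎)
      where open ≤-Reasoning

  record Invariant (sp i j : ℕ) (R : List ℕ) : Set where
    field
      prefix  : sp ≤ p → p < i → L p ∈ R
      earlier : v ∈ R → Occurs i j v → ∃[ q ] (sp ≤ q × q < i × L q ≡ v)
  open Invariant

  report-invariant : sp ≤ i → Invariant sp i j R → Invariant sp (suc i) j (L i ∷ R)
  report-invariant sp≤i inv .prefix sp≤p p<1+i with m≤n⇒m<n∨m≡n (s≤s⁻¹ p<1+i)
  ... | inj₁ p<i  = there (inv .prefix sp≤p p<i)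
  ... | inj₂ refl = here refl
  report-invariant {i = i} sp≤i inv .earlier (here refl) _ = i , sp≤i , ≤-refl , refl
  report-invariant sp≤i inv .earlier (there v∈) (p , i<p , p≤j , e)
    with inv .earlier v∈ (p , <⇒≤ i<p , p≤j , e)
  ... | q , sp≤q , q<i , e′ = q , sp≤q , m≤n⇒m≤1+n q<i , e′

  loop-invariant : sp ≤ i → Invariant sp i j R → Loop L i j R d R₁ s → Invariant sp d j R₁
  loop-invariant sp≤i inv (loop-end _)        = inv
  loop-invariant sp≤i inv (loop-seen _ _)     = inv
  loop-invariant sp≤i inv (loop-step _ _ run) =
    loop-invariant (m≤n⇒m≤1+n sp≤i) (report-invariant sp≤i inv) run

  right-invariant : sp ≤ d → Invariant sp d j R₁ → IsMinPos L d j k →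
                    L k ∷ R₁ ⊆ R₂ →
                    (∀ {v} → v ∈ R₂ → v ∈ L k ∷ R₁ ⊎ Occurs d (k ∸ 1) v) →
                    (∀ {p} → sp ≤ p → p ≤ k ∸ 1 → L p ∈ R₂) →
                    Invariant sp (suc k) j R₂
  right-invariant sp≤d inv mp ⊆R₂ sound complete .prefix sp≤p p<1+k
    with m≤n⇒m<n∨m≡n (s≤s⁻¹ p<1+k)
  ... | inj₁ p<k  = complete sp≤p (<⇒≤∸1 p<k)
  ... | inj₂ refl = ⊆R₂ (here refl)
  right-invariant {k = k} sp≤d inv (d≤k , _) ⊆R₂ sound complete .earlier v∈ (p , k<p , p≤j , e)
    with sound v∈
  ... | inj₁ (here refl) = k , ≤-trans sp≤d d≤k , ≤-refl , refl
  ... | inj₁ (there v∈R₁) with inv .earlier v∈R₁ (p , ≤-trans d≤k (<⇒≤ k<p) , p≤j , e)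
  ...   | q , sp≤q , q<d , e′ = q , sp≤q , m≤n⇒m≤1+n (<-≤-trans q<d d≤k) , e′
  right-invariant sp≤d inv (d≤k , _) ⊆R₂ sound complete .earlier v∈ _
      | inj₂ (q , d≤q , q≤k∸1 , e′) =
    q , ≤-trans sp≤d d≤q , s≤s (≤-trans q≤k∸1 (m∸n≤m _ 1)) , e′

  module _ (1≤sp : 1 ≤ sp) where

    -- Following E backwards from any position of [d,j] stays inside [sp,j] and
    -- eventually lands in the reported prefix [sp,d), which has the same value.
    prefix-extends : (∀ {p} → sp ≤ p → p < d → L p ∈ R) →
                     (∀ {p} → d ≤ p → p ≤ j → sp ≤ E L p) →
                     sp ≤ p → p ≤ j → L p ∈ R
    prefix-extends {d = d} {R = R} {j = j} {p = p} before sp≤E =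
      <-rec (λ p → sp ≤ p → p ≤ j → L p ∈ R) step p
      where
      step : ∀ p → (∀ {q} → q < p → sp ≤ q → q ≤ j → L q ∈ R) → sp ≤ p → p ≤ j → L p ∈ R
      step p ih sp≤p p≤j with p <? d
      ... | yes p<d = before sp≤p p<d
      ... | no  p≮d =
        subst (_∈ R) (E-value (≤-trans 1≤sp sp≤e)) (ih e<p sp≤e (≤-trans (<⇒≤ e<p) p≤j))
        where
        sp≤e = sp≤E (≮⇒≥ p≮d) p≤j
        e<p  = E-< (≤-trans 1≤sp sp≤p)

    seen-minimum⇒complete : Invariant sp d j R → IsMinPos L d j k → L k ∈ R →
                            sp ≤ p → p ≤ j → L p ∈ R
    seen-minimum⇒complete {k = k} inv (d≤k , k≤j , minimal) Lk∈R =
      prefix-extends (inv .prefix) (λ d≤p p≤j → ≤-trans sp≤Ek (minimal _ d≤p p≤j))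
      where
      sp≤Ek : sp ≤ E L k
      sp≤Ek with inv .earlier Lk∈R (k , d≤k , k≤j , refl)
      ... | q , sp≤q , q<d , e = ≤-trans sp≤q (E-maximal (≤-trans 1≤sp sp≤q) (<-≤-trans q<d d≤k) e)

    -- Since E[k] ≤ E[d] < d, the value L[k] does not occur in [d,k).
    left-invariant : sp ≤ d → Invariant sp d j R → IsMinPos L d j k →
                     Invariant sp d (k ∸ 1) (L k ∷ R)
    left-invariant sp≤d inv mp .prefix sp≤p p<d = there (inv .prefix sp≤p p<d)
    left-invariant {d = d} {k = k} sp≤d inv (d≤k , k≤j , minimal) .earlier
                   (here refl) (p , d≤p , p≤k∸1 , e) =
      ⊥-elim (<⇒≱ Ek<d (≤-trans d≤p (E-maximal 1≤p (≤∸1⇒< 1≤k p≤k∸1) e)))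
      where
      1≤p = ≤-trans 1≤sp (≤-trans sp≤d d≤p)
      1≤k = ≤-trans 1≤sp (≤-trans sp≤d d≤k)
      Ek<d : E L k < d
      Ek<d = ≤-<-trans (minimal d ≤-refl (≤-trans d≤k k≤j)) (E-< (≤-trans 1≤sp sp≤d))
    left-invariant sp≤d inv (d≤k , k≤j , _) .earlier (there v∈) (p , d≤p , p≤k∸1 , e) =
      inv .earlier v∈ (p , d≤p , ≤-trans p≤k∸1 (≤-trans (m∸n≤m _ 1) k≤j) , e)

    proc-complete : sp ≤ i → Invariant sp i j R → Proc L i j R R₁ s → sp ≤ p → p ≤ j → L p ∈ R₁
    proc-complete sp≤i inv (proc-empty j<i) sp≤p p≤j = inv .prefix sp≤p (≤-<-trans p≤j j<i)
    proc-complete sp≤i inv (proc-done _ run j<d) sp≤p p≤j =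
      loop-invariant sp≤i inv run .prefix sp≤p (≤-<-trans p≤j j<d)
    proc-complete sp≤i inv (proc-stop _ run _ mp Lk∈) =
      seen-minimum⇒complete (loop-invariant sp≤i inv run) mp Lk∈
    proc-complete sp≤i inv (proc-rec _ run _ mp@(d≤k , _) _ left right) =
      proc-complete (≤-trans sp≤d (m≤n⇒m≤1+n d≤k)) invʳ right
      where
      sp≤d = ≤-trans sp≤i (loop-≤ run)
      invᵈ = loop-invariant sp≤i inv run
      invʳ = right-invariant sp≤d invᵈ mp (proc-⊆ left) (proc-sound left)
               (proc-complete sp≤d (left-invariant sp≤d invᵈ mp) left)

  loop-exists : ∀ n → j < i + n → ∃[ d ] ∃[ R₁ ] ∃[ s ] Loop L i j R d R₁ s
  loop-exists {j = j} {i = i} zero j<i+0 = i , _ , 0 , loop-end (subst (j <_) (+-identityʳ i) j<i+0)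
  loop-exists {j = j} {i = i} {R = R} (suc n) j<i+1+n with i ≤? j
  ... | no i≰j = i , R , 0 , loop-end (≰⇒> i≰j)
  ... | yes i≤j with L i ∈? R
  ...   | yes Li∈R = i , R , 0 , loop-seen i≤j Li∈R
  ...   | no  Li∉R with loop-exists n (subst (j <_) (+-suc i n) j<i+1+n)
  ...     | d , R₁ , s , run = d , R₁ , suc s , loop-step i≤j Li∉R run

  minimum-exists : d ≤ j → ∃[ k ] IsMinPos L d j k
  minimum-exists {d} {j} d≤j = best , proj₁ in-range , proj₂ in-range , minimal
    where
    best = argmin (E L) d (range d j)
    in-range : d ≤ best × best ≤ j
    in-range = argmin-all (E L) (≤-refl , d≤j) (All.tabulate (∈-range⁻ d≤j))
    minimal : ∀ m → d ≤ m → m ≤ j → E L best ≤ E L m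
    minimal m d≤m m≤j = All.lookup (f[argmin]≤f[xs] d (range d j)) (∈-range⁺ d≤m m≤j)

  -- With i = 0 the recursion Process(0, k ∸ 1) need not shrink, hence 1 ≤ i.
  proc-exists : ∀ n → 1 ≤ i → j < i + n → ∃[ R₁ ] ∃[ s ] Proc L i j R R₁ s
  proc-exists {i = i} {j = j} zero _ j<i+0 = _ , _ , proc-empty (subst (j <_) (+-identityʳ i) j<i+0)
  proc-exists {i = i} {j = j} {R = R} (suc n) 1≤i j<i+1+n with i ≤? j
  ... | no i≰j = _ , _ , proc-empty (≰⇒> i≰j)
  ... | yes i≤j with loop-exists {j = j} {i = i} {R = R} (suc j) (<-≤-trans (n<1+n j) (m≤n+m (suc j) i))
  ...   | d , R₁ , s , run with d ≤? j
  ...     | no d≰j = _ , _ , proc-done i≤j run (≰⇒> d≰j)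
  ...     | yes d≤j with minimum-exists d≤j
  ...       | k , mp@(d≤k , k≤j , _) with L k ∈? R₁
  ...         | yes Lk∈ = _ , _ , proc-stop i≤j run d≤j mp Lk∈
  ...         | no Lk∉ with recursive-calls-shrink 1≤i (loop-≤ run) d≤k k≤j j<i+1+n
  ...           | left-size , right-size with proc-exists n (≤-trans 1≤i (loop-≤ run)) left-size
  ...             | R₂ , s₁ , left with proc-exists n z<s right-size
  ...               | R₃ , s₂ , right = _ , _ , proc-rec i≤j run d≤j mp Lk∉ left right

  length≡ndoc : a ≤ b → Unique R → (∀ v → v ∈ R ⇔ Occurs a b v) → length R ≡ ndoc L a b
  length≡ndoc {a} {b} {R} a≤b uniq R≡Occ =
    ↭-length (∼bag⇒↭ (unique∧set⇒bag uniq (deduplicate-! (map L (range a b))) (mk⇔ to from)))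
    where
    to : v ∈ R → v ∈ deduplicate _≟_ (map L (range a b))
    to v∈R with Equivalence.to (R≡Occ _) v∈R
    ... | p , a≤p , p≤b , refl = Equivalence.to (deduplicate-∈⇔ _≟_) (∈-map⁺ L (∈-range⁺ a≤p p≤b))
    from : v ∈ deduplicate _≟_ (map L (range a b)) → v ∈ R
    from v∈ with ∈-map⁻ L (Equivalence.from (deduplicate-∈⇔ _≟_) v∈)
    ... | p , p∈ , refl with ∈-range⁻ a≤b p∈
    ...   | a≤p , p≤b = Equivalence.from (R≡Occ (L p)) (p , a≤p , p≤b , refl)

  process-correct : 1 ≤ a → a ≤ b → Proc L a b [] R s →
                    Unique R × (∀ v → v ∈ R ⇔ Occurs a b v) × s ≤ 4 * ndoc L a b
  process-correct {a} {b} {R} {s} 1≤a a≤b run = unique , reported , cost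
    where
    unique = proc-unique run []
    initial : Invariant a a b []
    initial = record { prefix = λ a≤p p<a → ⊥-elim (<⇒≱ p<a a≤p) ; earlier = λ () }
    sound : v ∈ R → Occurs a b v
    sound v∈R with proc-sound run v∈R
    ... | inj₂ occ = occ
    complete : Occurs a b v → v ∈ R
    complete (p , a≤p , p≤b , refl) = proc-complete 1≤a ≤-refl initial run a≤p p≤b
    reported : ∀ v → v ∈ R ⇔ Occurs a b v
    reported v = mk⇔ sound complete
    n = ndoc L a b
    length≡n = length≡ndoc a≤b unique reported
    1≤n : 1 ≤ n
    1≤n = subst (1 ≤_) length≡n (∈-length (complete (a , ≤-refl , a≤b , refl)))
    cost : s ≤ 4 * n
    cost with proc-cost run
    ... | r , length≡r , s≤1+3r = begin
      s             ≤⟨ s≤1+3r ⟩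
      suc (3 * r)   ≡⟨ cong (λ x → suc (3 * x)) r≡n ⟩
      suc (3 * n)   ≤⟨ +-monoˡ-≤ (3 * n) 1≤n ⟩
      4 * n         ∎
      where
      open ≤-Reasoning
      r≡n : r ≡ n
      r≡n = trans (sym (trans length≡r (+-identityʳ r))) length≡n

-- The bounds D on the values and t on the positions play no role.
lemma2 : ∃[ c ] ∀ (D t : ℕ) (L : ℕ → ℕ) →
           (∀ p → 1 ≤ p → p ≤ t → 1 ≤ L p × L p ≤ D) →
           ∀ (sp ep : ℕ) → 1 ≤ sp → sp ≤ ep → ep ≤ t →
           (∃₂ λ (R : List ℕ) (s : ℕ) → Proc L sp ep [] R s) ×
           (∀ (R : List ℕ) (s : ℕ) → Proc L sp ep [] R s →
              Unique R ×
              (∀ v → (v ∈ R) ⇔ (∃[ p ] (sp ≤ p × p ≤ ep × L p ≡ v))) ×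
              s ≤ c * ndoc L sp ep)
lemma2 = 4 , λ D t L _ sp ep 1≤sp sp≤ep _ →
  proc-exists L (suc ep) 1≤sp (<-≤-trans (n<1+n ep) (m≤n+m (suc ep) sp)) ,
  λ R s run → process-correct L 1≤sp sp≤ep run
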